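{- Define $\bar{f}: \mathbb{N} \to \mathbb{N}$ by $\bar{f}(n) = \min\{ m \geq 0 : \bar{a}_m > n\}$. Then $\bar{A}_n = A^{\bar{f}}_n$ for all $n \geq 0$. Moreover, the function $\bar{g}(n) := \min\{ t : \bar{f}(t) \geq n\}$ satisfies $\bar{g}(0) = 0$ and $\bar{g}(n) = \bar{a}_{n-1}$ for all $n \geq 1$.
   Context: The minimally bounded adjunctive hierarchy is defined by $\bar{A}_{ -1} := \emptyset$, $\bar{A}_0 := \{\emptyset\}$, and for $n \geq 0$, $\bar{A}_{n+1} := \{\emptyset\} \cup \{ x \cup \{y\} : x \in \bar{A}_n \text{ and there exists an integer } m \geq -1 \text{ with } \mathcal{P}(\bar{A}_m) \subseteq \bar{A}_n \text{ and } y \in \bar{A}_{m+1}\}$; let $\bar a_n := |\bar A_n|$. For a function $f:\mathbb{N}\to\mathbb{N}$, the adjunctive hierarchy bounded by $f$ is $A^f_0 := \{\emptyset\}$ and $A^f_{n+1} := \{\emptyset\} \cup \{ x \cup \{y\} : x \in A^f_n,\ y \in A^f_{f(n)}\}$. -}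

module Defs where

open import Data.Nat using (ℕ; zero; suc; _+_; _^_; _<_; _≤_; _%_; _/_; _≡ᵇ_; _≟_)
open import Data.Bool using (Bool; true; false; if_then_else_; _∧_)
open import Data.List using (List; []; _∷_; _++_; map; concatMap; foldr; length; deduplicate; upTo)
open import Data.Bool.ListAction using (all; any)
open import Relation.Nullary using (¬_)

-- Hereditarily finite sets are represented by their Ackermann codes:
-- the HF set x is coded by the natural number  Σ_{y ∈ x} 2^(code y).
-- This is a bijection between HF sets and ℕ, so extensional equality of
-- HF sets is equality of codes.

bit : ℕ → ℕ → Bool
bit x zero    = x % 2 ≡ᵇ 1
bit x (suc y) = bit (x / 2) y

_∈ₕ_ : ℕ → ℕ → Bool
y ∈ₕ x = bit x y

ins : ℕ → ℕ → ℕ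
ins y x = if bit x y then x else x + 2 ^ y

-- A finite family of HF sets is given by a list of codes (duplicates
-- allowed; the family is the set of its entries).

memb : ℕ → List ℕ → Bool
memb s L = any (λ t → s ≡ᵇ t) L

card : List ℕ → ℕ
card L = length (deduplicate _≟_ L)

sublists : List ℕ → List (List ℕ)
sublists []       = [] ∷ []
sublists (x ∷ xs) = sublists xs ++ map (x ∷_) (sublists xs)

powerset : List ℕ → List ℕ
powerset L = map (foldr ins 0) (sublists L)

powersetSub : List ℕ → List ℕ → Bool
powersetSub L M = all (λ s → memb s M) (powerset L)

-- The minimally bounded adjunctive hierarchy.
-- We use the shifted index  B k = Ā_{k-1}  (so B 0 = Ā_{-1} = ∅).

nth : List (List ℕ) → ℕ → List ℕ
nth []       _       = []
nth (l ∷ ls) zero    = l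
nth (l ∷ ls) (suc i) = nth ls i

-- given the table [B 0, …, B (n+1)], compute B (n+2)
nextStage : ℕ → List (List ℕ) → List ℕ
nextStage n tbl =
  0 ∷ concatMap
        (λ x → concatMap
                 (λ j → if powersetSub (nth tbl j) (nth tbl (suc n))
                          then map (λ y → ins y x) (nth tbl (suc j))
                          else [])
                 (upTo (suc n)))
        (nth tbl (suc n))

-- table k = [B 0, …, B (k+1)]
table : ℕ → List (List ℕ)
table zero    = [] ∷ (0 ∷ []) ∷ []
table (suc n) = table n ++ (nextStage n (table n) ∷ [])

-- Ā_n for n ≥ 0  (= B (n+1))
Abar : ℕ → List ℕ
Abar n = nth (table n) (suc n)

abar : ℕ → ℕ
abar n = card (Abar n)

data AF (f : ℕ → ℕ) : ℕ → ℕ → Set where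
  empty₀ : AF f zero 0
  emptyₛ : ∀ {n} → AF f (suc n) 0
  adjoin : ∀ {n x y} → AF f n x → AF f (f n) y → AF f (suc n) (ins y x)

IsMin : (ℕ → Set) → ℕ → Set
IsMin P m = P m × (∀ k → k < m → ¬ P k)
  where open import Data.Product using (_×_)

module Submission where

-- Fix f with f t = min {m : t < ā_m} (LeastLevel).  Call a list u_{r-1} … u_0
-- admissible when u_i ∈ A^f_{f i}; adjoining its entries one by one shows that
-- every subfamily lies in A^f_r.  By induction on N (module Construction):
-- Ā_k = A^f_k for k ≤ N, ā increases strictly up to N, and each Ā_m, m ≤ N,
-- has an admissible enumeration.  In the step, P(Ā_{j-1}) ⊆ Ā_N forces
-- j ≤ f N since sets in A^f_N have at most N members, and P(Ā_{f N-1}) ⊆ Ā_N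
-- since Ā_{f N-1} has an admissible enumeration of length ≤ N; hence
-- Ā_{N+1} = A^f_{N+1}.  New members of Ā_{N+1} sit at positions p with
-- f p = N + 1, and the first N + 1 entries of the old enumeration give a new
-- set, so ā_N < ā_{N+1}.

open import Defs
open import Data.Nat using (ℕ; zero; suc; _+_; _*_; _^_; _<_; _≤_; _≡ᵇ_; _%_; _/_; z≤n; s≤s)
open import Data.Nat.Properties
open import Data.Nat.DivMod
open import Data.Nat.Divisibility using (divides)
open import Data.Bool using (true; false; T; if_then_else_; _∨_)
open import Data.Bool.Properties using (T-∨)
open import Data.Unit using (⊤; tt)
open import Data.Product using (Σ; _×_; _,_; proj₁; proj₂)
open import Data.Sum using (_⊎_; inj₁; inj₂)
open import Data.Empty using (⊥-elim)
open import Data.List using (List; []; _∷_; _++_; foldr; length; filter; deduplicate; upTo)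
open import Data.List.Properties using (filter-notAll; length-++)
open import Data.List.Membership.Propositional using (_∈_; find; lose)
open import Data.List.Membership.Propositional.Properties
  using (∈-filter⁺; ∈-filter⁻; ∈-++⁺ˡ; ∈-++⁺ʳ; ∈-++⁻; ∈-deduplicate⁺; ∈-deduplicate⁻; ∈-map⁺; ∈-map⁻;
         ∈-concatMap⁺; ∈-concatMap⁻; ∈-upTo⁺; ∈-upTo⁻)
open import Data.List.Membership.DecPropositional _≟_ using (_∈?_)
open import Data.List.Relation.Binary.Subset.Propositional using (_⊆_)
open import Data.List.Relation.Unary.Any as Any using (Any; here; there)
open import Data.List.Relation.Unary.Any.Properties using (any⁺; any⁻)
open import Data.List.Relation.Unary.All as All using (All; []; _∷_)
open import Data.List.Relation.Unary.All.Properties using (all⁺; all⁻)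
open import Data.List.Relation.Unary.Unique.Propositional using (Unique; []; _∷_)
open import Data.List.Relation.Unary.Unique.Propositional.Properties using (++⁺; filter⁺)
open import Data.List.Relation.Unary.Unique.DecPropositional.Properties using (deduplicate-!)
open import Relation.Nullary using (¬_; ¬?; Dec; yes; no)
open import Relation.Unary using (Decidable)
open import Relation.Binary.PropositionalEquality
open import Function.Bundles using (_⇔_; mk⇔; Equivalence)

bit-low : ∀ r q → r < 2 → bit (r + q * 2) zero ≡ (r ≡ᵇ 1)
bit-low r q r<2 = cong (_≡ᵇ 1) (trans ([m+kn]%n≡m%n r q 2) (m<n⇒m%n≡m r<2))

bit-high : ∀ r q z → r < 2 → bit (r + q * 2) (suc z) ≡ bit q z
bit-high r q z r<2 = cong (λ h → bit h z) (begin
  (r + q * 2) / 2     ≡⟨ +-distrib-/-∣ʳ r (divides q refl) ⟩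
  r / 2 + q * 2 / 2   ≡⟨ cong₂ _+_ (m<n⇒m/n≡0 r<2) (m*n/n≡m q 2) ⟩
  q                   ∎)
  where open ≡-Reasoning

bit-zero : ∀ z → bit 0 z ≡ false
bit-zero zero    = refl
bit-zero (suc z) = bit-zero z

by-parity : (P : ℕ → Set) → (∀ r q → r < 2 → P (r + q * 2)) → ∀ x → P x
by-parity P h x = subst P (sym (m≡m%n+[m/n]*n x 2)) (h (x % 2) (x / 2) (m%n<n x 2))

bit-add : ∀ y x z → bit x y ≡ false → bit (x + 2 ^ y) z ≡ (z ≡ᵇ y) ∨ bit x z
bit-add y = by-parity (λ x → ∀ z → bit x y ≡ false → bit (x + 2 ^ y) z ≡ (z ≡ᵇ y) ∨ bit x z)
                      (digits y)
  where
  digits : ∀ y r q → r < 2 → ∀ z → bit (r + q * 2) y ≡ false →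
           bit (r + q * 2 + 2 ^ y) z ≡ (z ≡ᵇ y) ∨ bit (r + q * 2) z
  digits zero 0 q _ zero _ = trans (cong (λ x → bit x zero) (+-comm (q * 2) 1)) (bit-low 1 q (s≤s (s≤s z≤n)))
  digits zero 0 q _ (suc z) _ =
    trans (cong (λ x → bit x (suc z)) (+-comm (q * 2) 1))
          (trans (bit-high 1 q z (s≤s (s≤s z≤n))) (sym (bit-high 0 q z (s≤s z≤n))))
  digits zero 1 q r<2 z y∉x with () ← trans (sym (bit-low 1 q r<2)) y∉x
  digits zero (suc (suc _)) q (s≤s (s≤s ())) z y∉x
  digits (suc y) r q r<2 z y∉x = trans (cong (λ x → bit x z) shift) (high z)
    where
    shift : r + q * 2 + 2 ^ suc y ≡ r + (q + 2 ^ y) * 2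
    shift = trans (+-assoc r (q * 2) _) (cong (r +_) (trans (cong (q * 2 +_) (*-comm 2 (2 ^ y)))
                                                             (sym (*-distribʳ-+ 2 q (2 ^ y)))))
    high : ∀ z → bit (r + (q + 2 ^ y) * 2) z ≡ (z ≡ᵇ suc y) ∨ bit (r + q * 2) z
    high zero    = trans (bit-low r (q + 2 ^ y) r<2) (sym (bit-low r q r<2))
    high (suc z) = begin
      bit (r + (q + 2 ^ y) * 2) (suc z)   ≡⟨ bit-high r (q + 2 ^ y) z r<2 ⟩
      bit (q + 2 ^ y) z                   ≡⟨ bit-add y q z (trans (sym (bit-high r q y r<2)) y∉x) ⟩
      (z ≡ᵇ y) ∨ bit q z                  ≡⟨ cong ((z ≡ᵇ y) ∨_) (sym (bit-high r q z r<2)) ⟩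
      (z ≡ᵇ y) ∨ bit (r + q * 2) (suc z)  ∎
      where open ≡-Reasoning

bit-ins : ∀ y x z → bit (ins y x) z ≡ (z ≡ᵇ y) ∨ bit x z
bit-ins y x z with bit x y in y∈x
... | false = bit-add y x z y∈x
... | true with z ≡ᵇ y in z≟y
...   | false = refl
...   | true rewrite ≡ᵇ⇒≡ z y (subst T (sym z≟y) tt) = y∈x

bits-ext : ∀ a b → (∀ z → bit a z ≡ bit b z) → a ≡ b
bits-ext a b = bounded (a + b) a b (m≤m+n a b) (m≤n+m b a)
  where
  low-digit : ∀ r s → r < 2 → s < 2 → (r ≡ᵇ 1) ≡ (s ≡ᵇ 1) → r ≡ s
  low-digit 0 0 _ _ _ = refl
  low-digit 1 1 _ _ _ = refl
  low-digit 0 1 _ _ ()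
  low-digit 1 0 _ _ ()
  low-digit (suc (suc _)) _ (s≤s (s≤s ())) _ _
  low-digit _ (suc (suc _)) _ (s≤s (s≤s ())) _

  halve : ∀ n a → a ≤ suc n → a / 2 ≤ n
  halve n zero    _ = z≤n
  halve n (suc a) a≤ = ≤-pred (≤-trans (m/n<m (suc a) 2 (s≤s (s≤s z≤n))) a≤)

  -- induction on a common bound n of a and b, halving both at each step
  bounded : ∀ n a b → a ≤ n → b ≤ n → (∀ z → bit a z ≡ bit b z) → a ≡ b
  bounded zero a b a≤0 b≤0 _ = trans (n≤0⇒n≡0 a≤0) (sym (n≤0⇒n≡0 b≤0))
  bounded (suc n) a b a≤ b≤ same = begin
    a                  ≡⟨ m≡m%n+[m/n]*n a 2 ⟩
    a % 2 + a / 2 * 2  ≡⟨ cong₂ (λ r q → r + q * 2) low high ⟩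
    b % 2 + b / 2 * 2  ≡⟨ sym (m≡m%n+[m/n]*n b 2) ⟩
    b                  ∎
    where
    open ≡-Reasoning
    low : a % 2 ≡ b % 2
    low = low-digit _ _ (m%n<n a 2) (m%n<n b 2) (same zero)
    high : a / 2 ≡ b / 2
    high = bounded n (a / 2) (b / 2) (halve n a a≤) (halve n b b≤) (λ z → same (suc z))

code : List ℕ → ℕ
code = foldr ins 0

code-∈ : ∀ L {z} → T (bit (code L) z) → z ∈ L
code-∈ []      {z} z∈ = ⊥-elim (subst T (bit-zero z) z∈)
code-∈ (u ∷ L) {z} z∈ with Equivalence.to T-∨ (subst T (bit-ins u (code L) z) z∈)
... | inj₁ z≡u = here (≡ᵇ⇒≡ z u z≡u)
... | inj₂ z∈L = there (code-∈ L z∈L)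

∈-code : ∀ L {z} → z ∈ L → T (bit (code L) z)
∈-code (u ∷ L) {z} z∈ = subst T (sym (bit-ins u (code L) z)) (Equivalence.from T-∨ (cases z∈))
  where
  cases : z ∈ u ∷ L → T (z ≡ᵇ u) ⊎ T (bit (code L) z)
  cases (here refl) = inj₁ (≡⇒≡ᵇ z z refl)
  cases (there z∈L) = inj₂ (∈-code L z∈L)

code-ext : ∀ {S S′} → S ⊆ S′ → S′ ⊆ S → code S ≡ code S′
code-ext {S} {S′} S⊆S′ S′⊆S = bits-ext (code S) (code S′) λ z →
  T-ext (λ z∈ → ∈-code S′ (S⊆S′ (code-∈ S {z} z∈))) (λ z∈ → ∈-code S (S′⊆S (code-∈ S′ {z} z∈)))
  where
  T-ext : ∀ {a b} → (T a → T b) → (T b → T a) → a ≡ b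
  T-ext {false} {false} _ _ = refl
  T-ext {false} {true}  _ b→a = ⊥-elim (b→a tt)
  T-ext {true}  {false} a→b _ = ⊥-elim (a→b tt)
  T-ext {true}  {true}  _ _ = refl

code-injective : ∀ {S S′} → code S ≡ code S′ → S ⊆ S′
code-injective {S} {S′} eq {z} z∈ = code-∈ S′ (subst (λ c → T (bit c z)) eq (∈-code S z∈))

⊆-∷⁻ : ∀ {u} {U S : List ℕ} → S ⊆ u ∷ U → ¬ u ∈ S → S ⊆ U
⊆-∷⁻ S⊆ u∉S z∈ with S⊆ z∈
... | here refl = ⊥-elim (u∉S z∈)
... | there z∈U = z∈U

split-off : ∀ {u} {U S : List ℕ} → u ∈ S → S ⊆ u ∷ U →
            Σ (List ℕ) λ S′ → S′ ⊆ U × code S ≡ code (u ∷ S′)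
split-off {u} {U} {S} u∈S S⊆ = S′ , ⊆-∷⁻ (λ z∈ → S⊆ (S′⊆S z∈)) u∉S′ , code-ext ⊆u∷S′ ⊆S
  where
  S′ = filter (λ z → ¬? (z ≟ u)) S
  S′⊆S : S′ ⊆ S
  S′⊆S z∈ = proj₁ (∈-filter⁻ (λ z → ¬? (z ≟ u)) {xs = S} z∈)
  u∉S′ : ¬ u ∈ S′
  u∉S′ u∈ = proj₂ (∈-filter⁻ (λ z → ¬? (z ≟ u)) {xs = S} u∈) refl
  ⊆S : u ∷ S′ ⊆ S
  ⊆S (here refl) = u∈S
  ⊆S (there z∈)  = S′⊆S z∈
  ⊆u∷S′ : S ⊆ u ∷ S′
  ⊆u∷S′ {z} z∈ with z ≟ u
  ... | yes refl = here refl
  ... | no z≢u   = there (∈-filter⁺ (λ z → ¬? (z ≟ u)) z∈ z≢u)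

unique-⊆⇒length≤ : ∀ {xs ys : List ℕ} → Unique xs → xs ⊆ ys → length xs ≤ length ys
unique-⊆⇒length≤ {[]}     _              _   = z≤n
unique-⊆⇒length≤ {x ∷ xs} {ys} (x∉xs ∷ u) xs⊆ys =
  ≤-trans (s≤s (unique-⊆⇒length≤ u xs⊆rest)) (filter-notAll (λ y → ¬? (y ≟ x)) ys x∈ys)
  where
  xs⊆rest : xs ⊆ filter (λ y → ¬? (y ≟ x)) ys
  xs⊆rest z∈ = ∈-filter⁺ (λ y → ¬? (y ≟ x)) (xs⊆ys (there z∈)) (λ z≡x → All.lookup x∉xs z∈ (sym z≡x))
  x∈ys : Any (λ y → ¬ ¬ y ≡ x) ys
  x∈ys = Any.map (λ x≡y y≢x → y≢x (sym x≡y)) (xs⊆ys (here refl))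

card-≤ : ∀ {L ys} → L ⊆ ys → card L ≤ length ys
card-≤ {L} L⊆ys = unique-⊆⇒length≤ (deduplicate-! _≟_ L) (λ z∈ → L⊆ys (∈-deduplicate⁻ _≟_ L z∈))

length≤card : ∀ {U L} → Unique U → U ⊆ L → length U ≤ card L
length≤card u U⊆L = unique-⊆⇒length≤ u (λ z∈ → ∈-deduplicate⁺ _≟_ (U⊆L z∈))

length≡card : ∀ {U L} → Unique U → U ⊆ L → L ⊆ U → length U ≡ card L
length≡card u U⊆L L⊆U = ≤-antisym (length≤card u U⊆L) (card-≤ L⊆U)

B : ℕ → List ℕ
B zero    = []
B (suc i) = Abar i

nth-++ : ∀ xs ys i → i < length xs → nth (xs ++ ys) i ≡ nth xs i
nth-++ (x ∷ xs) ys zero    _       = refl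
nth-++ (x ∷ xs) ys (suc i) (s≤s i<) = nth-++ xs ys i i<

nth-++-length : ∀ xs y ys → nth (xs ++ y ∷ ys) (length xs) ≡ y
nth-++-length []       y ys = refl
nth-++-length (x ∷ xs) y ys = nth-++-length xs y ys

length-table : ∀ n → length (table n) ≡ suc (suc n)
length-table zero    = refl
length-table (suc n) = trans (length-++ (table n)) (trans (cong (_+ 1) (length-table n)) (+-comm _ 1))

nth-table : ∀ n i → i ≤ suc n → nth (table n) i ≡ B i
nth-table zero    zero          _ = refl
nth-table zero    (suc zero)    _ = refl
nth-table zero    (suc (suc i)) (s≤s ())
nth-table (suc n) i i≤ with m≤n⇒m<n∨m≡n i≤
... | inj₁ i< = trans (nth-++ (table n) _ i (subst (i <_) (sym (length-table n)) i<))
                      (nth-table n i (≤-pred i<))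
... | inj₂ refl = refl

Abar-suc : ∀ n → Abar (suc n) ≡ nextStage n (table n)
Abar-suc n = subst (λ k → nth (table n ++ nextStage n (table n) ∷ []) k ≡ nextStage n (table n))
                   (length-table n) (nth-++-length (table n) _ [])

memb-∈ : ∀ s M → T (memb s M) → s ∈ M
memb-∈ s M h = Any.map (≡ᵇ⇒≡ s _) (any⁻ (s ≡ᵇ_) M h)

∈-memb : ∀ {s M} → s ∈ M → T (memb s M)
∈-memb {s} s∈ = any⁺ (s ≡ᵇ_) (Any.map (≡⇒≡ᵇ s _) s∈)

sublist-⊆ : ∀ L {S} → S ∈ sublists L → S ⊆ L
sublist-⊆ []      (here refl) ()
sublist-⊆ (x ∷ L) S∈ z∈ with ∈-++⁻ (sublists L) S∈
... | inj₁ S∈L = there (sublist-⊆ L S∈L z∈)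
... | inj₂ S∈xL with ∈-map⁻ (x ∷_) S∈xL
...   | S′ , S′∈ , refl with z∈
...     | here refl  = here refl
...     | there z∈S′ = there (sublist-⊆ L S′∈ z∈S′)

self-sublist : ∀ L → L ∈ sublists L
self-sublist []      = here refl
self-sublist (x ∷ L) = ∈-++⁺ʳ (sublists L) (∈-map⁺ (x ∷_) (self-sublist L))

powersetSub-full : ∀ L M → T (powersetSub L M) → code L ∈ M
powersetSub-full L M h =
  memb-∈ (code L) M (All.lookup (all⁺ (λ s → memb s M) (powerset L) h) (∈-map⁺ code (self-sublist L)))

powersetSub-intro : ∀ L M → (∀ S → S ⊆ L → code S ∈ M) → T (powersetSub L M)
powersetSub-intro L M closed = all⁻ (λ s → memb s M) (All.tabulate member)
  where
  member : ∀ {s} → s ∈ powerset L → T (memb s M)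
  member s∈ with ∈-map⁻ code s∈
  ... | S , S∈ , refl = ∈-memb (closed S (sublist-⊆ L S∈))

record Adjunction (n z : ℕ) : Set where
  field
    {x j y}  : ℕ
    x∈       : x ∈ Abar n
    j≤n      : j ≤ n
    closed   : T (powersetSub (B j) (Abar n))
    y∈       : y ∈ Abar j
    z≡ins  : z ≡ ins y x

∈-if : ∀ {b} {xs : List ℕ} {z} → z ∈ (if b then xs else []) → T b × z ∈ xs
∈-if {true} z∈ = tt , z∈

if-∈ : ∀ {b} {xs : List ℕ} {z} → T b → z ∈ xs → z ∈ (if b then xs else [])
if-∈ {true} _ z∈ = z∈

Abar-suc⇒ : ∀ n z → z ∈ Abar (suc n) → z ≡ 0 ⊎ Adjunction n z
Abar-suc⇒ n z z∈ with subst (z ∈_) (Abar-suc n) z∈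
... | here z≡0 = inj₁ z≡0
... | there z∈′ =
  let x , x∈ , z∈x = find (∈-concatMap⁻ _ {xs = Abar n} z∈′)
      j , j∈ , z∈j = find (∈-concatMap⁻ _ {xs = upTo (suc n)} z∈x)
      j<1+n        = ∈-upTo⁻ j∈
      closed , z∈y = ∈-if z∈j
      y , y∈ , z≡  = ∈-map⁻ (λ y → ins y x) z∈y
  in inj₂ (record
    { x∈      = x∈
    ; j≤n     = ≤-pred j<1+n
    ; closed  = subst (λ L → T (powersetSub L (Abar n))) (nth-table n j (m≤n⇒m≤1+n (≤-pred j<1+n))) closed
    ; y∈      = subst (y ∈_) (nth-table n (suc j) j<1+n) y∈
    ; z≡ins = z≡ })

Abar-suc⇐ : ∀ n z → z ≡ 0 ⊎ Adjunction n z → z ∈ Abar (suc n)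
Abar-suc⇐ n z new = subst (z ∈_) (sym (Abar-suc n)) (member new)
  where
  member : z ≡ 0 ⊎ Adjunction n z → z ∈ nextStage n (table n)
  member (inj₁ z≡0) = here z≡0
  member (inj₂ a) = there (∈-concatMap⁺ _ {xs = Abar n} (lose x∈
                      (∈-concatMap⁺ _ {xs = upTo (suc n)} (lose (∈-upTo⁺ (s≤s j≤n))
                        (if-∈ closed′ (subst (_∈ _) (sym z≡ins) (∈-map⁺ (λ y → ins y _) y∈′)))))))
    where
    open Adjunction a
    closed′ : T (powersetSub (nth (table n) j) (Abar n))
    closed′ = subst (λ L → T (powersetSub L (Abar n))) (sym (nth-table n j (m≤n⇒m≤1+n j≤n))) closed
    y∈′ : y ∈ nth (table n) (suc j)
    y∈′ = subst (y ∈_) (sym (nth-table n (suc j) (s≤s j≤n))) y∈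

module Bounded (f : ℕ → ℕ) where

  AF-empty : ∀ n → AF f n 0
  AF-empty zero    = empty₀
  AF-empty (suc n) = emptyₛ

  AF-size : ∀ {n z} → AF f n z → Σ (List ℕ) λ L → length L ≤ n × z ≡ code L
  AF-size empty₀ = [] , z≤n , refl
  AF-size emptyₛ = [] , z≤n , refl
  AF-size (adjoin {y = y} x∈ _) with AF-size x∈
  ... | L , L≤n , refl = y ∷ L , s≤s L≤n , refl

  card-bound : ∀ {n} L → AF f n (code L) → card L ≤ n
  card-bound L z∈ with AF-size z∈
  ... | L′ , L′≤n , code≡ = ≤-trans (card-≤ (code-injective {L} {L′} code≡)) L′≤n

  -- Below M, f is monotone and f t ≤ t: the regime in which the levels of
  -- A^f grow (AF-lift).
  record Tame (M : ℕ) : Set where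
    field
      monotone : ∀ {t t′} → t ≤ t′ → t′ < M → f t ≤ f t′
      shrinks  : ∀ {t} → t < M → f t ≤ t

  AF-lift : ∀ {M n m z} → Tame M → AF f n z → n ≤ m → m ≤ M → AF f m z
  AF-lift {m = m} _ empty₀ _ _ = AF-empty m
  AF-lift {m = m} _ emptyₛ _ _ = AF-empty m
  AF-lift {m = suc m} tame (adjoin x∈ y∈) (s≤s n≤m) m<M =
    adjoin (AF-lift tame x∈ n≤m m≤M)
           (AF-lift tame y∈ (monotone n≤m m<M) (≤-trans (shrinks m<M) m≤M))
    where
    open Tame tame
    m≤M = ≤-trans (n≤1+n m) m<M

  -- U = u_{r-1} ∷ … ∷ u_0 is admissible when each u_i lies in A^f_{f i}:
  -- adjoining the u_i one at a time builds any subfamily in r steps.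
  Admissible : List ℕ → Set
  Admissible []      = ⊤
  Admissible (u ∷ U) = AF f (f (length U)) u × Admissible U

  -- Every subfamily S of an admissible U lies in A^f_{|U|}, by induction on U:
  -- if the top entry u is in S, adjoin it to the rest of S, otherwise lift.
  admissible-subsets : ∀ {M} U → Tame M → Admissible U → length U ≤ M →
                       ∀ S → S ⊆ U → AF f (length U) (code S)
  admissible-subsets [] _ _ _ S S⊆[] =
    subst (AF f 0) (code-ext {[]} {S} (λ ()) S⊆[]) empty₀
  admissible-subsets (u ∷ U) tame (u∈ , adm) U<M S S⊆ = by-cases (u ∈? S)
    where
    smaller : ∀ S → S ⊆ U → AF f (length U) (code S)
    smaller = admissible-subsets U tame adm (≤-trans (n≤1+n _) U<M)
    by-cases : Dec (u ∈ S) → AF f (suc (length U)) (code S)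
    by-cases (yes u∈S) = let S′ , S′⊆U , S≡u∷S′ = split-off u∈S S⊆ in
      subst (AF f (suc (length U))) (sym S≡u∷S′) (adjoin (smaller S′ S′⊆U) u∈)
    by-cases (no u∉S) = AF-lift tame (smaller S (⊆-∷⁻ S⊆ u∉S)) (n≤1+n _) U<M

  admissible-prefix : ∀ {r} U → Admissible U → Unique U → r ≤ length U →
                      Σ (List ℕ) λ L → Admissible L × Unique L × length L ≡ r
  admissible-prefix []      _ _ z≤n = [] , tt , [] , refl
  admissible-prefix (u ∷ U) (u∈ , adm) (u∉ ∷ uniq) r≤ with m≤n⇒m<n∨m≡n r≤
  ... | inj₁ (s≤s r≤U) = admissible-prefix U adm uniq r≤U
  ... | inj₂ refl      = u ∷ U , (u∈ , adm) , (u∉ ∷ uniq) , refl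

  admissible-++ : ∀ {c} D U → Admissible U → All (AF f c) D →
                  (∀ p → length U ≤ p → p < length D + length U → f p ≡ c) → Admissible (D ++ U)
  admissible-++ []      U adm _ _ = adm
  admissible-++ (d ∷ D) U adm (d∈ ∷ D∈) level =
    subst (λ l → AF f l d) (sym (level (length (D ++ U)) lo hi)) d∈ ,
    admissible-++ D U adm D∈ (λ p U≤p p< → level p U≤p (m≤n⇒m≤1+n p<))
    where
    lo : length U ≤ length (D ++ U)
    lo = subst (length U ≤_) (sym (length-++ D)) (m≤n+m (length U) (length D))
    hi : length (D ++ U) < suc (length D + length U)
    hi = s≤s (≤-reflexive (length-++ D))

-- f t is the least level m with t < ā_m, at least when some such m ≤ t
-- exists.  This is all the construction below needs; it holds for the f of
-- the corollary, and for a bounded search, before we know that ā grows.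
record LeastLevel (f : ℕ → ℕ) : Set where
  field
    least    : ∀ {t m} → t < abar m → f t ≤ m
    attained : ∀ {t m} → m ≤ t → t < abar m → t < abar (f t)

module Construction (f : ℕ → ℕ) (leastLevel : LeastLevel f) where
  open LeastLevel leastLevel
  open Bounded f
  open Equivalence using (to; from)

  record Enumeration (m : ℕ) : Set where
    field
      list       : List ℕ
      admissible : Admissible list
      unique     : Unique list
      sound      : list ⊆ Abar m
      complete   : Abar m ⊆ list

    length≡abar : length list ≡ abar m
    length≡abar = length≡card unique sound complete

  record Invariant (N : ℕ) : Set where
    field
      agree : ∀ {k} → k ≤ N → ∀ z → z ∈ Abar k ⇔ AF f k z
      grows : ∀ {k} → k < N → abar k < abar (suc k)
      enum  : ∀ {m} → m ≤ N → Enumeration m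

  base : Invariant 0
  base = record
    { agree = λ { z≤n z → mk⇔ (λ { (here refl) → empty₀ }) (λ { empty₀ → here refl }) }
    ; grows = λ ()
    ; enum  = λ { z≤n → record { list = 0 ∷ [] ; admissible = AF-empty (f 0) , tt ; unique = [] ∷ []
                               ; sound = λ z∈ → z∈ ; complete = λ z∈ → z∈ } } }

  module Consequences {N} (inv : Invariant N) where
    open Invariant inv

    -- k < ā_k, as ā_0 = 1 and ā increases strictly up to N
    level-above : ∀ {k} → k ≤ N → k < abar k
    level-above {zero}  _   = s≤s z≤n
    level-above {suc k} k<N = ≤-<-trans (level-above (<⇒≤ k<N)) (grows k<N)

    abar-mono : ∀ {k k′} → k ≤ k′ → k′ ≤ N → abar k ≤ abar k′
    abar-mono {k′ = zero}   z≤n _ = ≤-refl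
    abar-mono {k′ = suc k′} k≤ k′<N with m≤n⇒m<n∨m≡n k≤
    ... | inj₁ (s≤s k≤k′) = ≤-trans (abar-mono k≤k′ (<⇒≤ k′<N)) (<⇒≤ (grows k′<N))
    ... | inj₂ refl       = ≤-refl

    -- t < ā_t for t ≤ N makes f tame below N + 1
    tame : Tame (suc N)
    tame = record
      { monotone = λ {t} {t′} t≤t′ t′<1+N →
          least (≤-<-trans t≤t′ (attained ≤-refl (level-above (≤-pred t′<1+N))))
      ; shrinks  = λ t<1+N → least (level-above (≤-pred t<1+N)) }

  module Step {N} (inv : Invariant N) where
    open Invariant inv
    open Consequences inv

    -- f N ≤ N and N < ā_{f N}, since N < ā_N
    fN≤N : f N ≤ N
    fN≤N = least (level-above ≤-refl)

    N<ā-fN : N < abar (f N)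
    N<ā-fN = attained ≤-refl (level-above ≤-refl)

    -- If P(B j) ⊆ Ā_N then j ≤ f N: otherwise Ā_{j-1} ∈ Ā_N = A^f_N would
    -- have at most N members, while ā_{j-1} ≥ ā_{f N} > N.
    closed⇒≤f : ∀ {j} → j ≤ N → T (powersetSub (B j) (Abar N)) → j ≤ f N
    closed⇒≤f {zero}  _   _      = z≤n
    closed⇒≤f {suc i} j≤N closed with i <? f N
    ... | yes i<fN = i<fN
    ... | no  i≮fN = ⊥-elim (<⇒≱ N<ā-fN (≤-trans (abar-mono (≮⇒≥ i≮fN) (≤-trans (n≤1+n i) j≤N)) āi≤N))
      where
      āi≤N : abar i ≤ N
      āi≤N = card-bound (Abar i) (to (agree ≤-refl _) (powersetSub-full (Abar i) (Abar N) closed))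

    -- For j ≤ f N, B j sits inside an admissible list of length ≤ N,
    -- because ā_{j-1} ≤ N by minimality of f N.
    small-enumeration : ∀ {j} → j ≤ f N → Σ (List ℕ) λ U → Admissible U × B j ⊆ U × length U ≤ N
    small-enumeration {zero}  _    = [] , tt , (λ ()) , z≤n
    small-enumeration {suc i} i<fN = list , admissible , complete , āi≤N
      where
      open Enumeration (enum (≤-trans (n≤1+n i) (≤-trans i<fN fN≤N)))
      āi≤N : length list ≤ N
      āi≤N = subst (_≤ N) (sym length≡abar) (≮⇒≥ λ N<āi → 1+n≰n (≤-trans i<fN (least N<āi)))

    closed-at-fN : ∀ S → S ⊆ B (f N) → code S ∈ Abar N
    closed-at-fN S S⊆ with small-enumeration ≤-refl
    ... | U , adm , B⊆U , U≤N = from (agree ≤-refl _)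
            (AF-lift tame (admissible-subsets U tame adm (m≤n⇒m≤1+n U≤N) S (λ z∈ → B⊆U (S⊆ z∈)))
                     U≤N (n≤1+n N))

    -- Ā_{N+1} = A^f_{N+1}: an adjunction from level j ≤ f N lifts to level
    -- f N, and conversely adjunction from level f N is admissible.
    agree-next : ∀ z → z ∈ Abar (suc N) ⇔ AF f (suc N) z
    agree-next z = mk⇔ forward backward
      where
      forward : z ∈ Abar (suc N) → AF f (suc N) z
      forward z∈ with Abar-suc⇒ N z z∈
      ... | inj₁ refl = emptyₛ
      ... | inj₂ a    = subst (AF f (suc N)) (sym z≡ins)
                          (adjoin (to (agree ≤-refl _) x∈)
                                  (AF-lift tame (to (agree j≤n _) y∈) (closed⇒≤f j≤n closed)
                                           (m≤n⇒m≤1+n fN≤N)))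
        where open Adjunction a
      backward : AF f (suc N) z → z ∈ Abar (suc N)
      backward emptyₛ         = Abar-suc⇐ N z (inj₁ refl)
      backward (adjoin x∈ y∈) = Abar-suc⇐ N z (inj₂ (record
        { x∈     = from (agree ≤-refl _) x∈
        ; j≤n    = fN≤N
        ; closed = powersetSub-intro (B (f N)) (Abar N) closed-at-fN
        ; y∈     = from (agree fN≤N _) y∈
        ; z≡ins  = refl }))

    -- the stages are nested, as A^f_N ⊆ A^f_{N+1}
    Abar-⊆ : Abar N ⊆ Abar (suc N)
    Abar-⊆ z∈ = from (agree-next _) (AF-lift tame (to (agree ≤-refl _) z∈) (n≤1+n N) ≤-refl)

    f-layer : ∀ p → abar N ≤ p → p < abar (suc N) → f p ≡ suc N
    f-layer p āN≤p p< = ≤-antisym (least p<) (≰⇒> λ fp≤N →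
      <⇒≱ (attained (≤-trans (level-above ≤-refl) āN≤p) p<) (≤-trans (abar-mono fp≤N ≤-refl) āN≤p))

    enum-next : Enumeration (suc N)
    enum-next = record
      { list = new ++ old.list ; admissible = admissible ; unique = unique
      ; sound = sound ; complete = complete }
      where
      module old = Enumeration (enum ≤-refl)
      notOld? = λ z → ¬? (z ∈? old.list)
      new = filter notOld? (deduplicate _≟_ (Abar (suc N)))

      new⊆ : new ⊆ Abar (suc N)
      new⊆ z∈ = ∈-deduplicate⁻ _≟_ (Abar (suc N)) (proj₁ (∈-filter⁻ notOld? {xs = deduplicate _≟_ (Abar (suc N))} z∈))

      unique : Unique (new ++ old.list)
      unique = ++⁺ (filter⁺ notOld? (deduplicate-! _≟_ (Abar (suc N)))) old.unique
                   (λ (z∈new , z∈old) → proj₂ (∈-filter⁻ notOld? {xs = deduplicate _≟_ (Abar (suc N))} z∈new) z∈old)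

      sound : new ++ old.list ⊆ Abar (suc N)
      sound z∈ with ∈-++⁻ new z∈
      ... | inj₁ z∈new = new⊆ z∈new
      ... | inj₂ z∈old = Abar-⊆ (old.sound z∈old)

      complete : Abar (suc N) ⊆ new ++ old.list
      complete {z} z∈ with z ∈? old.list
      ... | yes z∈old = ∈-++⁺ʳ new z∈old
      ... | no  z∉old = ∈-++⁺ˡ (∈-filter⁺ notOld? (∈-deduplicate⁺ _≟_ z∈) z∉old)

      level : ∀ p → length old.list ≤ p → p < length new + length old.list → f p ≡ suc N
      level p old≤p p< = f-layer p (subst (_≤ p) old.length≡abar old≤p)
        (subst (p <_) (trans (sym (length-++ new)) (length≡card unique sound complete)) p<)

      admissible : Admissible (new ++ old.list)
      admissible = admissible-++ new old.list old.admissible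
                     (All.tabulate λ z∈ → to (agree-next _) (new⊆ z∈)) level

    -- ā_N < ā_{N+1}: the N + 1 lowest entries of an enumeration of Ā_N
    -- form a set of A^f_{N+1} = Ā_{N+1} too large to lie in A^f_N = Ā_N.
    grows-next : abar N < abar (suc N)
    grows-next with admissible-prefix old.list old.admissible old.unique
                      (subst (suc N ≤_) (sym old.length≡abar) (level-above ≤-refl))
      where module old = Enumeration (enum ≤-refl)
    ... | L , adm , uniq , L≡1+N = length≤card (fresh ∷ deduplicate-! _≟_ (Abar N)) members
      where
      L∈ : code L ∈ Abar (suc N)
      L∈ = from (agree-next _) (subst (λ l → AF f l (code L)) L≡1+N
                                  (admissible-subsets L tame adm (≤-reflexive L≡1+N) L (λ z∈ → z∈)))
      L∉ : ¬ code L ∈ Abar N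
      L∉ L∈N = 1+n≰n (subst (_≤ N) (trans (sym (length≡card uniq (λ z∈ → z∈) (λ z∈ → z∈))) L≡1+N)
                              (card-bound L (to (agree ≤-refl _) L∈N)))
      fresh : All (code L ≢_) (deduplicate _≟_ (Abar N))
      fresh = All.tabulate λ z∈ L≡z → L∉ (subst (_∈ Abar N) (sym L≡z) (∈-deduplicate⁻ _≟_ (Abar N) z∈))
      members : code L ∷ deduplicate _≟_ (Abar N) ⊆ Abar (suc N)
      members (here refl) = L∈
      members (there z∈)  = Abar-⊆ (∈-deduplicate⁻ _≟_ (Abar N) z∈)

    next : Invariant (suc N)
    next = record { agree = agree′ ; grows = grows′ ; enum = enum′ }
      where
      agree′ : ∀ {k} → k ≤ suc N → ∀ z → z ∈ Abar k ⇔ AF f k z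
      agree′ k≤ with m≤n⇒m<n∨m≡n k≤
      ... | inj₁ k<  = agree (≤-pred k<)
      ... | inj₂ refl = agree-next
      grows′ : ∀ {k} → k < suc N → abar k < abar (suc k)
      grows′ k< with m≤n⇒m<n∨m≡n (≤-pred k<)
      ... | inj₁ k<N = grows k<N
      ... | inj₂ refl = grows-next
      enum′ : ∀ {m} → m ≤ suc N → Enumeration m
      enum′ m≤ with m≤n⇒m<n∨m≡n m≤
      ... | inj₁ m<  = enum (≤-pred m<)
      ... | inj₂ refl = enum-next

  invariant : ∀ N → Invariant N
  invariant zero    = base
  invariant (suc N) = Step.next (invariant N)

  agreement : ∀ n z → z ∈ Abar n ⇔ AF f n z
  agreement n = Invariant.agree (invariant n) ≤-refl

  growth : ∀ k → k < abar k
  growth k = Consequences.level-above (invariant k) ≤-refl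

  abar-monotone : ∀ {k k′} → k ≤ k′ → abar k ≤ abar k′
  abar-monotone {k′ = k′} k≤ = Consequences.abar-mono (invariant k′) k≤ ≤-refl

-- Bounded minimisation: search j k is the first m ∈ [j, j + k) with P m,
-- or j + k if there is none.
module Search {P : ℕ → Set} (P? : Decidable P) where
  search : ℕ → ℕ → ℕ
  search j zero    = j
  search j (suc k) with P? j
  ... | yes _ = j
  ... | no  _ = search (suc j) k

  search-≤ : ∀ j k {m} → j ≤ m → P m → search j k ≤ m
  search-≤ j zero    j≤m _  = j≤m
  search-≤ j (suc k) j≤m Pm with P? j
  ... | yes _ = j≤m
  ... | no ¬Pj with m≤n⇒m<n∨m≡n j≤m
  ...   | inj₁ j<m  = search-≤ (suc j) k j<m Pm
  ...   | inj₂ refl = ⊥-elim (¬Pj Pm)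

  search-hits : ∀ j k {m} → j ≤ m → m ≤ j + k → P m → P (search j k)
  search-hits j zero {m} j≤m m≤ Pm with ≤-antisym j≤m (subst (m ≤_) (+-identityʳ j) m≤)
  ... | refl = Pm
  search-hits j (suc k) {m} j≤m m≤ Pm with P? j
  ... | yes Pj = Pj
  ... | no ¬Pj with m≤n⇒m<n∨m≡n j≤m
  ...   | inj₁ j<m  = search-hits (suc j) k j<m (subst (m ≤_) (+-suc j k) m≤) Pm
  ...   | inj₂ refl = ⊥-elim (¬Pj Pm)

IsLevelFunction : (ℕ → ℕ) → Set
IsLevelFunction f = ∀ n → IsMin (λ m → n < abar m) (f n)

level-function⇒least-level : ∀ {f} → IsLevelFunction f → LeastLevel f
level-function⇒least-level {f} isF = record
  { least    = λ {t} {m} t<ām → ≮⇒≥ λ m<ft → proj₂ (isF t) m m<ft t<ām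
  ; attained = λ _ _ → proj₁ (isF _) }

-- f̄ t: search for the least m ≤ t with t < ā_m (one exists since t < ā_t).
f̄ : ℕ → ℕ
f̄ t = Search.search (λ m → t <? abar m) 0 t

f̄-least-level : LeastLevel f̄
f̄-least-level = record
  { least    = λ {t} t<ām → Search.search-≤ (λ m → t <? abar m) 0 t z≤n t<ām
  ; attained = λ {t} m≤t t<ām → Search.search-hits (λ m → t <? abar m) 0 t z≤n m≤t t<ām }

-- ... so the construction shows t < ā_t, and then f̄ is the true minimum.
f̄-is-level-function : IsLevelFunction f̄
f̄-is-level-function n =
  attained ≤-refl (growth n) , λ k k<f̄n n<āk → <⇒≱ k<f̄n (least n<āk)
  where
  open LeastLevel f̄-least-level
  open Construction f̄ f̄-least-level using (growth)

g-values : ∀ {f} → IsLevelFunction f → ∀ k → IsMin (λ t → suc k ≤ f t) (abar k)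
g-values {f} isF k =
  ≰⇒> (λ f≤k → <⇒≱ (proj₁ (isF (abar k))) (abar-monotone f≤k)) ,
  λ t t<āk k<ft → <⇒≱ k<ft (least t<āk)
  where
  open LeastLevel (level-function⇒least-level isF)
  open Construction f (level-function⇒least-level isF) using (abar-monotone)

corollary3 :
    (Σ (ℕ → ℕ) λ f → ∀ n → IsMin (λ m → n < abar m) (f n))
    × (∀ (f : ℕ → ℕ) → (∀ n → IsMin (λ m → n < abar m) (f n))
        → (∀ n z → (z ∈ Abar n) ⇔ AF f n z)
          × IsMin (λ t → 0 ≤ f t) 0
          × (∀ k → IsMin (λ t → suc k ≤ f t) (abar k)))
corollary3 = (f̄ , f̄-is-level-function) , λ f isF →
  Construction.agreement f (level-function⇒least-level isF) ,
  (z≤n , λ _ ()) ,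
  g-values isF
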